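{- Let $M$ be a system execution for the Lazy Set language satisfying the axioms A0, A1 and A2. If $Z$ is an event with $\mathrm{Add}^1(Z)$ or $\mathrm{Rem}^1(Z)$, then $\gamma(Z)<Z$.
   Context: A structure $M$ for the Lazy Set language has a set of events, each low-level (an "action") or high-level; unary predicates $\mathrm{Add},\mathrm{Rem},\mathrm{Cnt}$ on events; a binary relation $<$ on events; functions $\mathrm{Begin},\mathrm{End}$ from events to events, $\chi$ from events to $\{0,1,f\}$, $\mathrm{val}$ from events to $\mathbb N$, $\gamma$ from events to events. $M$ is a system execution if $<$ is a strict partial order on the events such that for every event $x$ there is a finite set $E$ with $x<y$ for all $y\notin E$; $\mathrm{Begin}(e)=\mathrm{End}(e)=e$ for low-level $e$; and $X<Y$ iff $\mathrm{End}(X)<\mathrm{Begin}(Y)$. Shorthands: $\mathrm{Add}^p(a):\equiv\mathrm{Add}(a)\wedge\chi(a)=p$, similarly $\mathrm{Rem}^p,\mathrm{Cnt}^p$; $\mathrm{Op}^p(a):\equiv(\mathrm{Add}(a)\vee\mathrm{Rem}(a)\vee\mathrm{Cnt}(a))\wedge\chi(a)=p$ for $p\in\{0,1\}$. A0: $\mathrm{Add},\mathrm{Rem},\mathrm{Cnt}$ pairwise disjoint; Add and Rem events low-level, Cnt events high-level; $\mathrm{Begin}(X),\mathrm{End}(X)$ low-level for all $X$; $\mathrm{Begin}(E)=\mathrm{End}(E)=E$ for Add/Rem events, $\mathrm{Begin}(E)<\mathrm{End}(E)$ for Cnt events; $<$ is linear on low-level events. A1: for every $A$ with $\mathrm{Op}^1(A)$: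 $\mathrm{Add}^0(\gamma(A))$, $\mathrm{val}(\gamma(A))=\mathrm{val}(A)$, $\gamma(A)<\mathrm{End}(A)$, and there is no $R$ with $\mathrm{Rem}^1(R)$, $\gamma(R)=\gamma(A)$, $\gamma(A)<R<A$. A2: for all $A,B$: if $\mathrm{Op}^0(B)$, $\mathrm{Add}^0(A)$, $A<B$, $\mathrm{val}(A)=\mathrm{val}(B)$, then there is $R$ with $\mathrm{Rem}^1(R)$, $A=\gamma(R)$, $R<\mathrm{End}(B)$. -}

module Defs where

open import Level using (Level; suc; _⊔_)
open import Data.Nat using (ℕ)
open import Data.Product using (_×_; ∃; ∃-syntax; Σ-syntax; _,_)
open import Data.Sum using (_⊎_)
open import Data.List using (List)
open import Data.List.Membership.Propositional using (_∈_)
open import Relation.Nullary using (¬_)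
open import Relation.Binary.PropositionalEquality using (_≡_)
open import Function.Bundles using (_⇔_)

data Val3 : Set where
  v0 v1 vf : Val3

record Structure : Set₁ where
  field
    Event    : Set
    LowLevel : Event → Set
    Add Rem Cnt : Event → Set
    _<_      : Event → Event → Set
    Begin End γ : Event → Event
    χ        : Event → Val3
    val      : Event → ℕ

  HighLevel : Event → Set
  HighLevel e = ¬ LowLevel e

  χ-is : Val3 → Event → Set
  χ-is p a = χ a ≡ p

  Op : Event → Set
  Op a = Add a ⊎ Rem a ⊎ Cnt a

  Addᵖ Remᵖ Cntᵖ Opᵖ : Val3 → Event → Set
  Addᵖ p a = Add a × χ a ≡ p
  Remᵖ p a = Rem a × χ a ≡ p
  Cntᵖ p a = Cnt a × χ a ≡ p
  Opᵖ  p a = Op a  × χ a ≡ p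

record IsSystemExecution (M : Structure) : Set where
  open Structure M
  field
    irrefl   : ∀ x → ¬ (x < x)
    trans    : ∀ x y z → x < y → y < z → x < z
    finitePast : ∀ x → ∃[ E ] (∀ y → ¬ (y ∈ E) → x < y)
    low-Begin : ∀ e → LowLevel e → Begin e ≡ e
    low-End   : ∀ e → LowLevel e → End e ≡ e
    <-BeginEnd : ∀ X Y → (X < Y) ⇔ (End X < Begin Y)

module _ (M : Structure) where
  open Structure M

  record A0 : Set where
    field
      disj-AddRem : ∀ e → Add e → ¬ Rem e
      disj-AddCnt : ∀ e → Add e → ¬ Cnt e
      disj-RemCnt : ∀ e → Rem e → ¬ Cnt e
      add-low  : ∀ e → Add e → LowLevel e
      rem-low  : ∀ e → Rem e → LowLevel e
      cnt-high : ∀ e → Cnt e → HighLevel e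
      begin-low : ∀ X → LowLevel (Begin X)
      end-low   : ∀ X → LowLevel (End X)
      add-BeginEnd : ∀ e → Add e → Begin e ≡ e × End e ≡ e
      rem-BeginEnd : ∀ e → Rem e → Begin e ≡ e × End e ≡ e
      cnt-BeginEnd : ∀ e → Cnt e → Begin e < End e
      low-linear : ∀ a b → LowLevel a → LowLevel b → a < b ⊎ a ≡ b ⊎ b < a

  A1 : Set
  A1 = ∀ A → Opᵖ v1 A →
         Addᵖ v0 (γ A) × val (γ A) ≡ val A × γ A < End A ×
         ¬ (∃[ R ] (Remᵖ v1 R × γ R ≡ γ A × γ A < R × R < A))

  A2 : Set
  A2 = ∀ A B → Opᵖ v0 B → Addᵖ v0 A → A < B → val A ≡ val B →
         ∃[ R ] (Remᵖ v1 R × A ≡ γ R × R < End B)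

module Submission where

open import Defs
open import Data.Sum using (_⊎_; inj₁; inj₂)
open import Data.Product using (_,_; proj₂)
open import Relation.Binary.PropositionalEquality using (_≡_; subst)

module _ (M : Structure) where
  open Structure M

  γ<self : A1 M → ∀ A → Opᵖ v1 A → End A ≡ A → γ A < A
  γ<self a1 A opA EndA≡A with a1 A opA
  ... | _ , _ , γA<EndA , _ = subst (γ A <_) EndA≡A γA<EndA

lemma3p3 : (M : Structure) → IsSystemExecution M → A0 M → A1 M → A2 M →
    let open Structure M in
    (Z : Event) → Addᵖ v1 Z ⊎ Remᵖ v1 Z → γ Z < Z
lemma3p3 M _ a0 a1 _ Z (inj₁ (addZ , χZ)) =
  γ<self M a1 Z (inj₁ addZ , χZ) (proj₂ (A0.add-BeginEnd a0 Z addZ))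
lemma3p3 M _ a0 a1 _ Z (inj₂ (remZ , χZ)) =
  γ<self M a1 Z (inj₂ (inj₁ remZ) , χZ) (proj₂ (A0.rem-BeginEnd a0 Z remZ))
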